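{- Let $n\ge2$ and $w=(a,u)\in S_n$, and write $\mathrm{IR}(w)=(M_0,\dots,M_{\mathrm{reg}(w)})$ and $\mathrm{IR}(u)=(m_0,\dots,m_{\mathrm{reg}(u)})$. Then $\mathrm{reg}(w)=\mathrm{reg}(u)+d_a(u)$ and $$M_j=\begin{cases} x_1^a\,\overrightarrow{m_j} & \text{if } j=0,1,\dots,\mathrm{reg}(u),\\ x_1^{a+j-\mathrm{reg}(u)}\,\overrightarrow{m_{\mathrm{reg}(u)}} & \text{if } j=\mathrm{reg}(u)+1,\dots,\mathrm{reg}(w).\end{cases}$$
   Context: A diagram is a finite subset of $\mathbb{Z}_{>0}\times\mathbb{Z}_{>0}$; $(r,c)$ is the cell in row $r$ (row 1 on top), column $c$. For a weak composition $\alpha$ (a sequence of nonnegative integers with finitely many nonzero entries), $x^\alpha=\prod_i x_i^{\alpha_i}$. For $v\in S_m$: $\mathrm{Rothe}(v)=\{(i,v(j)) : i<j,\ v(i)>v(j)\}$; $\mathrm{invcode}(v)$ has $i$-th entry $\#\{j>i : v(j)<v(i)\}$. For a diagram $D$, $\mathrm{dark}(D)$ is computed by scanning rows from bottom to top: for row $r$, if there is $(r,c)\in D$ such that $\mathrm{dark}(D)$ currently has no cell in column $c$, take the largest such $c$ and add $(r,c)$. The snow diagram of $v$ is obtained from $\mathrm{Rothe}(v)$ by adding, for each $(r,c)\in\mathrm{dark}(\mathrm{Rothe}(v))$, every cell $(r',c)$, $r'<r$, not in $\mathrm{Rothe}(v)$; $\mathrm{rajcode}(v)$ is the weak composition of its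 row counts. $\mathrm{reg}(v)$ is the sum of entries of $\mathrm{rajcode}(v)$ minus that of $\mathrm{invcode}(v)$. $\mathrm{IR}(v)=(m_0,\dots,m_{\mathrm{reg}(v)})$ with $m_0=x^{\mathrm{invcode}(v)}$ and $m_i=m_{i-1}x_p$ for $i>0$, where $p$ is the largest index such that $m_{i-1}x_p$ divides $x^{\mathrm{rajcode}(v)}$. For a monomial $m$, $\overrightarrow{m}$ is obtained by replacing each $x_i$ by $x_{i+1}$. Notation $w=(a,u)$: $a=\mathrm{invcode}(w)_1$ and $u\in S_{n-1}$ is the unique permutation with $\mathrm{invcode}(u)=(\mathrm{invcode}(w)_2,\mathrm{invcode}(w)_3,\dots)$. $d_c(u)$ is the number of cells of $\mathrm{dark}(\mathrm{Rothe}(u))$ in columns strictly greater than $c$. -}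

module Defs where

open import Data.Nat using (ℕ; zero; suc; _+_; _∸_; _⊔_; _≡ᵇ_; _<ᵇ_; _≤ᵇ_)
open import Data.Bool using (Bool; true; false; if_then_else_; _∧_; not; T?)
open import Data.List using (List; []; _∷_; _++_; map; filter; length; upTo; zip; concatMap; foldr; reverse)
open import Data.Bool.ListAction using (any)
open import Data.Nat.ListAction using (sum)
open import Data.Product using (_×_; _,_; proj₁; proj₂)
open import Data.List.Relation.Binary.Permutation.Propositional using (_↭_)

-- Permutations in one-line notation: w = [w(1), ..., w(n)]

range1 : ℕ → List ℕ
range1 n = map suc (upTo n)

IsPerm : ℕ → List ℕ → Set
IsPerm n w = w ↭ range1 n

indexed : List ℕ → List (ℕ × ℕ)
indexed w = zip (range1 (length w)) w

-- Diagrams: finite lists of cells (row , column)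

Cell : Set
Cell = ℕ × ℕ

cell≡ᵇ : Cell → Cell → Bool
cell≡ᵇ (r , c) (r' , c') = (r ≡ᵇ r') ∧ (c ≡ᵇ c')

memᵇ : Cell → List Cell → Bool
memᵇ x D = any (cell≡ᵇ x) D

invcode : List ℕ → List ℕ
invcode [] = []
invcode (x ∷ xs) = length (filter (λ y → T? (y <ᵇ x)) xs) ∷ invcode xs

rothe : List ℕ → List Cell
rothe w = concatMap (λ p → concatMap (λ q → cellIf p q) iw) iw
  where
  iw = indexed w
  cellIf : ℕ × ℕ → ℕ × ℕ → List Cell
  cellIf (i , vi) (j , vj) = if (i <ᵇ j) ∧ (vj <ᵇ vi) then (i , vj) ∷ [] else []

-- dark(D): scan rows bottom to top; in row r pick the largest column c
-- with (r,c) ∈ D such that dark has no cell in column c yet.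

maxList : List ℕ → ℕ
maxList = foldr _⊔_ 0

darkScan : List Cell → List ℕ → List Cell → List Cell
darkScan D [] acc = acc
darkScan D (r ∷ rs) acc with candidates
  where
  usedCol : ℕ → Bool
  usedCol c = any (λ x → proj₂ x ≡ᵇ c) acc
  candidates : List ℕ
  candidates = map proj₂ (filter (λ x → T? ((proj₁ x ≡ᵇ r) ∧ not (usedCol (proj₂ x)))) D)
... | [] = darkScan D rs acc
... | c ∷ cs = darkScan D rs ((r , maxList (c ∷ cs)) ∷ acc)

dark : List Cell → List Cell
dark D = darkScan D (reverse (range1 (maxList (map proj₁ D)))) []

snow : List ℕ → List Cell
snow w = R ++ concatMap added (dark R)
  where
  R = rothe w
  added : Cell → List Cell
  added (r , c) = map (λ r' → (r' , c))
    (filter (λ r' → T? (not (memᵇ (r' , c) R))) (range1 (r ∸ 1)))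

rowCount : List Cell → ℕ → ℕ
rowCount D r = length (filter (λ x → T? (proj₁ x ≡ᵇ r)) D)

rajcode : List ℕ → List ℕ
rajcode w = map (rowCount (snow w)) (range1 (length w))

reg : List ℕ → ℕ
reg w = sum (rajcode w) ∸ sum (invcode w)

-- Monomials as exponent lists (x^α with α = list; missing entries are 0)

Monomial : Set
Monomial = List ℕ

_·_ : Monomial → Monomial → Monomial
[] · β = β
(a ∷ α) · [] = a ∷ α
(a ∷ α) · (b ∷ β) = (a + b) ∷ (α · β)

x₁^ : ℕ → Monomial
x₁^ k = k ∷ []

-- x_p (1-indexed)
var : ℕ → Monomial
var zero = []
var (suc zero) = 1 ∷ []
var (suc (suc p)) = 0 ∷ var (suc p)

shift : Monomial → Monomial
shift m = 0 ∷ m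

divᵇ : Monomial → Monomial → Bool
divᵇ [] β = true
divᵇ (a ∷ α) [] = (a ≡ᵇ 0) ∧ divᵇ α []
divᵇ (a ∷ α) (b ∷ β) = (a ≤ᵇ b) ∧ divᵇ α β

largestDividing : Monomial → Monomial → List ℕ → ℕ → ℕ
largestDividing target m [] best = best
largestDividing target m (p ∷ ps) best =
  largestDividing target m ps (if divᵇ (m · var p) target then p else best)

-- one step of IR: m ↦ m·x_p with p largest such that m·x_p ∣ x^target.
-- (Candidates p ≤ length target suffice: larger p never divide.)
IRstep : Monomial → Monomial → Monomial
IRstep target m with largestDividing target m (range1 (length target)) 0
... | zero = m
... | suc p = m · var (suc p)

iterate : {A : Set} → (A → A) → ℕ → A → A
iterate f zero x = x
iterate f (suc k) x = f (iterate f k x)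

-- IR w j = m_j, the j-th entry of IR(w) = (m_0, …, m_{reg w})
IR : List ℕ → ℕ → Monomial
IR w j = iterate (IRstep (rajcode w)) j (invcode w)

d : ℕ → List ℕ → ℕ
d c u = length (filter (λ x → T? (c <ᵇ proj₂ x)) (dark (rothe u)))

-- Write w = (a , u) as w = (a + 1) ∷ map ι u, where ι fixes 1, …, a and raises larger values
-- by one. Then Rothe(w) is its first row stacked on a copy of Rothe(u) moved down one row (with
-- columns relabelled by ι), and the dark scan of rows 2, 3, … of w repeats the dark scan of u.
-- So below row 1 the snow diagram of w is that of u, while row 1 holds the a cells of Rothe(w)
-- plus one snow cell above every dark cell of u in a column c > a (for c ≤ a the cell (1, c)
-- already lies in Rothe(w)). Hence invcode(w) = (a , invcode u) and
-- rajcode(w) = (a + d_a(u) , rajcode u). An IR step raises the variable of largest index it can,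
-- so while the tail is strictly below x^rajcode(u) it moves the tail exactly as IR(u) does; once
-- the tail is saturated only x₁ can rise, and it does so d_a(u) more times.

module Submission where

open import Defs
open import Data.Nat using (ℕ; zero; suc; _+_; _∸_; _≤_; _<_; _⊔_; _≡ᵇ_; _<ᵇ_; _≤ᵇ_; z≤n; s≤s)
open import Data.Nat.Properties
open import Algebra.Properties.CommutativeSemigroup +-commutativeSemigroup using (interchange)
open import Data.Bool.Properties using (∨-assoc; ∨-zeroʳ; ∨-identityʳ)
open import Data.Bool using (Bool; true; false; if_then_else_; _∧_; _∨_; not; T?)
open import Data.Bool.ListAction using (any)
open import Data.Nat.ListAction using (sum)
open import Data.List using (List; []; _∷_; _++_; map; filterᵇ; length; upTo; downFrom; zip; concat; concatMap; reverse)
import Data.List.Properties as List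
open import Data.List.Relation.Unary.All as All using (All; []; _∷_)
open import Data.List.Relation.Unary.All.Properties using (++⁺; map⁺; filter⁺; concat⁺)
open import Data.List.Relation.Unary.Any using (here; there)
open import Data.List.Membership.Propositional using (_∈_)
open import Data.List.Membership.Propositional.Properties using (∈-map⁺; ∈-map⁻; ∈-upTo⁻)
open import Data.List.Relation.Binary.Permutation.Propositional
  using (_↭_; prep; swap; ↭-refl; ↭-sym; ↭-reflexive; module PermutationReasoning)
open import Data.List.Relation.Binary.Permutation.Propositional.Properties
  using (drop-∷; ∈-resp-↭; ↭-length)
import Data.List.Relation.Binary.Permutation.Propositional.Properties as ↭
open import Data.Product using (_×_; _,_; proj₁; proj₂; ∃)
import Data.Product
open import Data.Sum using (_⊎_; inj₁; inj₂)
open import Data.Empty using (⊥-elim)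
open import Function using (_∘_; id)
open import Relation.Binary.PropositionalEquality
open import Relation.Binary.Definitions using (tri<; tri≈; tri>)
open import Relation.Nullary using (Dec; yes; no; ¬_; proof)
open import Relation.Nullary.Reflects using (Reflects; ofʸ; ofⁿ)

module _ {A : Set} where

  reflects-true : ∀ {b} → Reflects A b → A → b ≡ true
  reflects-true (ofʸ _) _ = refl
  reflects-true (ofⁿ ¬a) a = ⊥-elim (¬a a)

  reflects-false : ∀ {b} → Reflects A b → ¬ A → b ≡ false
  reflects-false (ofʸ a) ¬a = ⊥-elim (¬a a)
  reflects-false (ofⁿ _) _ = refl

  true-reflects : ∀ {b} → Reflects A b → b ≡ true → A
  true-reflects (ofʸ a) _ = a

  false-reflects : ∀ {b} → Reflects A b → b ≡ false → ¬ A
  false-reflects (ofⁿ ¬a) _ = ¬a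

  reflects-det : ∀ {B : Set} {b b′} → Reflects A b → Reflects B b′ → (A → B) → (B → A) → b ≡ b′
  reflects-det (ofʸ a) (ofʸ _) _ _ = refl
  reflects-det (ofʸ a) (ofⁿ ¬b) f _ = ⊥-elim (¬b (f a))
  reflects-det (ofⁿ ¬a) (ofʸ b) _ f = ⊥-elim (¬a (f b))
  reflects-det (ofⁿ _) (ofⁿ _) _ _ = refl

∧-true : ∀ {a b} → (a ∧ b) ≡ true → (a ≡ true) × (b ≡ true)
∧-true {true} b≡true = refl , b≡true

≡ᵇ-reflects-≡ : ∀ m n → Reflects (m ≡ n) (m ≡ᵇ n)
≡ᵇ-reflects-≡ m n = proof (m ≟ n)

≡ᵇ-refl : ∀ n → (n ≡ᵇ n) ≡ true
≡ᵇ-refl n = reflects-true (≡ᵇ-reflects-≡ n n) refl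

<ᵇ-irrefl : ∀ n → (n <ᵇ n) ≡ false
<ᵇ-irrefl n = reflects-false (<ᵇ-reflects-< n n) (n≮n n)

module _ {A : Set} (p : A → Bool) where

  filterᵇ-accept : ∀ {x} xs → p x ≡ true → filterᵇ p (x ∷ xs) ≡ x ∷ filterᵇ p xs
  filterᵇ-accept {x} xs px with p x
  ... | true = refl

  filterᵇ-reject : ∀ {x} xs → p x ≡ false → filterᵇ p (x ∷ xs) ≡ filterᵇ p xs
  filterᵇ-reject {x} xs px with p x
  ... | false = refl

  filterᵇ-none : ∀ {xs} → All (λ x → p x ≡ false) xs → filterᵇ p xs ≡ []
  filterᵇ-none [] = refl
  filterᵇ-none (px ∷ pxs) = trans (filterᵇ-reject _ px) (filterᵇ-none pxs)

  filterᵇ-all : ∀ {xs} → All (λ x → p x ≡ true) xs → filterᵇ p xs ≡ xs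
  filterᵇ-all [] = refl
  filterᵇ-all (px ∷ pxs) = trans (filterᵇ-accept _ px) (cong (_ ∷_) (filterᵇ-all pxs))

  filterᵇ-++ : ∀ xs ys → filterᵇ p (xs ++ ys) ≡ filterᵇ p xs ++ filterᵇ p ys
  filterᵇ-++ = List.filter-++ (T? ∘ p)

  filterᵇ-map : {B : Set} (h : B → A) (xs : List B) →
    filterᵇ p (map h xs) ≡ map h (filterᵇ (p ∘ h) xs)
  filterᵇ-map h [] = refl
  filterᵇ-map h (x ∷ xs) with p (h x)
  ... | true = cong (h x ∷_) (filterᵇ-map h xs)
  ... | false = filterᵇ-map h xs

  length-filterᵇ≡sum : ∀ xs → length (filterᵇ p xs) ≡ sum (map (λ x → if p x then 1 else 0) xs)
  length-filterᵇ≡sum [] = refl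
  length-filterᵇ≡sum (x ∷ xs) with p x
  ... | true = cong suc (length-filterᵇ≡sum xs)
  ... | false = length-filterᵇ≡sum xs

  any-++ : ∀ xs ys → any p (xs ++ ys) ≡ any p xs ∨ any p ys
  any-++ [] ys = refl
  any-++ (x ∷ xs) ys = trans (cong (p x ∨_) (any-++ xs ys)) (sym (∨-assoc (p x) _ _))

  any-map : {B : Set} (h : B → A) (xs : List B) → any p (map h xs) ≡ any (p ∘ h) xs
  any-map h [] = refl
  any-map h (x ∷ xs) = cong (p (h x) ∨_) (any-map h xs)

  any-none : ∀ {xs} → All (λ x → p x ≡ false) xs → any p xs ≡ false
  any-none [] = refl
  any-none (px ∷ pxs) rewrite px = any-none pxs

  any-∈ : ∀ {x xs} → x ∈ xs → p x ≡ true → any p xs ≡ true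
  any-∈ (here refl) px rewrite px = refl
  any-∈ {xs = y ∷ _} (there x∈xs) px rewrite any-∈ x∈xs px = ∨-zeroʳ (p y)

module _ {A : Set} {p q : A → Bool} where

  filterᵇ-cong : ∀ {xs} → All (λ x → p x ≡ q x) xs → filterᵇ p xs ≡ filterᵇ q xs
  filterᵇ-cong {[]} [] = refl
  filterᵇ-cong {x ∷ xs} (e ∷ es) with p x | q x
  ... | true | true = cong (x ∷_) (filterᵇ-cong es)
  ... | false | false = filterᵇ-cong es

  any-cong : ∀ {xs} → All (λ x → p x ≡ q x) xs → any p xs ≡ any q xs
  any-cong [] = refl
  any-cong (e ∷ es) = cong₂ _∨_ e (any-cong es)

filterᵇ-∷ : {A : Set} (p : A → Bool) (x : A) (xs : List A) →
  filterᵇ p (x ∷ xs) ≡ (if p x then x ∷ [] else []) ++ filterᵇ p xs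
filterᵇ-∷ p x xs with p x
... | true = refl
... | false = refl

map-if-singleton : {A B : Set} (f : A → B) (b : Bool) (x : A) →
  map f (if b then x ∷ [] else []) ≡ (if b then f x ∷ [] else [])
map-if-singleton f true x = refl
map-if-singleton f false x = refl

sum-cong : {A : Set} {f h : A → ℕ} {xs : List A} → All (λ x → f x ≡ h x) xs →
  sum (map f xs) ≡ sum (map h xs)
sum-cong es = cong sum (List.map-cong-local es)

concatMap-[] : {A B : Set} (f : A → List B) {xs : List A} → All (λ x → f x ≡ []) xs → concatMap f xs ≡ []
concatMap-[] f [] = refl
concatMap-[] f (fx≡[] ∷ fxs≡[]) rewrite fx≡[] = concatMap-[] f fxs≡[]

All-concatMap : {A B : Set} {P : B → Set} (f : A → List B) {xs : List A} →
  All (All P ∘ f) xs → All P (concatMap f xs)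
All-concatMap f = concat⁺ ∘ map⁺

module StrictlyMonotone (g : ℕ → ℕ) (g-< : ∀ {y z} → y < z → g y < g z) where

  g-≤ : ∀ {y z} → y ≤ z → g y ≤ g z
  g-≤ y≤z with m≤n⇒m<n∨m≡n y≤z
  ... | inj₁ y<z = <⇒≤ (g-< y<z)
  ... | inj₂ refl = ≤-refl

  g-<⁻¹ : ∀ {y z} → g y < g z → y < z
  g-<⁻¹ gy<gz = ≰⇒> (λ z≤y → <⇒≱ gy<gz (g-≤ z≤y))

  g-injective : ∀ {y z} → g y ≡ g z → y ≡ z
  g-injective {y} {z} gy≡gz with <-cmp y z
  ... | tri< y<z _ _ = ⊥-elim (<⇒≢ (g-< y<z) gy≡gz)
  ... | tri≈ _ y≡z _ = y≡z
  ... | tri> _ _ z<y = ⊥-elim (<⇒≢ (g-< z<y) (sym gy≡gz))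

  g-<ᵇ : ∀ y z → (g y <ᵇ g z) ≡ (y <ᵇ z)
  g-<ᵇ y z = reflects-det (<ᵇ-reflects-< (g y) (g z)) (<ᵇ-reflects-< y z) g-<⁻¹ g-<

  g-≡ᵇ : ∀ y z → (g y ≡ᵇ g z) ≡ (y ≡ᵇ z)
  g-≡ᵇ y z = reflects-det (≡ᵇ-reflects-≡ (g y) (g z)) (≡ᵇ-reflects-≡ y z) g-injective (cong g)

  maxList-map : ∀ c cs → maxList (map g (c ∷ cs)) ≡ g (maxList (c ∷ cs))
  maxList-map c [] = trans (⊔-identityʳ (g c)) (cong g (sym (⊔-identityʳ c)))
  maxList-map c (c′ ∷ cs) with ≤-total c (maxList (c′ ∷ cs))
  ... | inj₁ c≤m = begin
    g c ⊔ maxList (map g (c′ ∷ cs)) ≡⟨ cong (g c ⊔_) (maxList-map c′ cs) ⟩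
    g c ⊔ g (maxList (c′ ∷ cs))     ≡⟨ m≤n⇒m⊔n≡n (g-≤ c≤m) ⟩
    g (maxList (c′ ∷ cs))           ≡⟨ cong g (m≤n⇒m⊔n≡n c≤m) ⟨
    g (c ⊔ maxList (c′ ∷ cs))       ∎
    where open ≡-Reasoning
  ... | inj₂ m≤c = begin
    g c ⊔ maxList (map g (c′ ∷ cs)) ≡⟨ cong (g c ⊔_) (maxList-map c′ cs) ⟩
    g c ⊔ g (maxList (c′ ∷ cs))     ≡⟨ m≥n⇒m⊔n≡m (g-≤ m≤c) ⟩
    g c                             ≡⟨ cong g (m≥n⇒m⊔n≡m m≤c) ⟨
    g (c ⊔ maxList (c′ ∷ cs))       ∎
    where open ≡-Reasoning

-- Rothe diagrams

upTo-suc : ∀ n → upTo (suc n) ≡ 0 ∷ map suc (upTo n)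
upTo-suc n = cong (0 ∷_) (sym (List.map-upTo suc n))

range1-suc : ∀ n → range1 (suc n) ≡ 1 ∷ map suc (range1 n)
range1-suc n = cong (map suc) (upTo-suc n)

length-range1 : ∀ n → length (range1 n) ≡ n
length-range1 n = trans (List.length-map suc (upTo n)) (List.length-upTo n)

shiftCell : (ℕ → ℕ) → Cell → Cell
shiftCell g = Data.Product.map suc g

indexed-∷-map : (g : ℕ → ℕ) (x : ℕ) (v : List ℕ) →
  indexed (x ∷ map g v) ≡ (1 , x) ∷ map (shiftCell g) (indexed v)
indexed-∷-map g x v = begin
  zip (range1 (suc (length (map g v)))) (x ∷ map g v)
    ≡⟨ cong (λ k → zip (range1 (suc k)) (x ∷ map g v)) (List.length-map g v) ⟩
  zip (range1 (suc (length v))) (x ∷ map g v)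
    ≡⟨ cong (λ is → zip is (x ∷ map g v)) (range1-suc (length v)) ⟩
  (1 , x) ∷ zip (map suc (range1 (length v))) (map g v)
    ≡⟨ cong ((1 , x) ∷_) (List.zip-map suc g (range1 (length v)) v) ⟩
  (1 , x) ∷ map (shiftCell g) (indexed v) ∎
  where open ≡-Reasoning

indexed-∷ : (x : ℕ) (v : List ℕ) → indexed (x ∷ v) ≡ (1 , x) ∷ map (shiftCell id) (indexed v)
indexed-∷ x v = trans (cong (λ v′ → indexed (x ∷ v′)) (sym (List.map-id v))) (indexed-∷-map id x v)

indexed-positive : (v : List ℕ) → All (λ p → 1 ≤ proj₁ p) (indexed v)
indexed-positive [] = []
indexed-positive (x ∷ v) = subst (All (λ p → 1 ≤ proj₁ p)) (sym (indexed-∷ x v))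
  (s≤s z≤n ∷ map⁺ (All.map m≤n⇒m≤1+n (indexed-positive v)))

map-proj₂-indexed : (v : List ℕ) → map proj₂ (indexed v) ≡ v
map-proj₂-indexed [] = refl
map-proj₂-indexed (x ∷ v) = trans (cong (map proj₂) (indexed-∷ x v))
  (cong (x ∷_) (trans (sym (List.map-∘ (indexed v))) (map-proj₂-indexed v)))

inversionCell : ℕ × ℕ → ℕ × ℕ → List Cell
inversionCell (i , vi) (j , vj) = if (i <ᵇ j) ∧ (vj <ᵇ vi) then (i , vj) ∷ [] else []

rotheIndexed : List (ℕ × ℕ) → List Cell
rotheIndexed iw = concatMap (λ p → concatMap (inversionCell p) iw) iw

firstRow : ℕ → List ℕ → List Cell
firstRow x v = concatMap (λ y → if y <ᵇ x then (1 , y) ∷ [] else []) v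

module RotheShift (g : ℕ → ℕ) (g-< : ∀ {y z} → y < z → g y < g z) where
  open StrictlyMonotone g g-<

  inversionCell-shift : ∀ p q → inversionCell (shiftCell g p) (shiftCell g q) ≡ map (shiftCell g) (inversionCell p q)
  inversionCell-shift (i , vi) (j , vj) rewrite g-<ᵇ vj vi with (i <ᵇ j) ∧ (vj <ᵇ vi)
  ... | true = refl
  ... | false = refl

  rotheIndexed-shift : (x : ℕ) (iv : List (ℕ × ℕ)) → All (λ p → 1 ≤ proj₁ p) iv →
    rotheIndexed ((1 , x) ∷ map (shiftCell g) iv)
      ≡ firstRow x (map g (map proj₂ iv)) ++ map (shiftCell g) (rotheIndexed iv)
  rotheIndexed-shift x iv iv-pos = cong₂ _++_ firstRowPart shiftedPart
    where
    open ≡-Reasoning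
    cellOfFirst : ℕ → List Cell
    cellOfFirst y = if y <ᵇ x then (1 , y) ∷ [] else []
    firstRowPart : concatMap (inversionCell (1 , x)) (map (shiftCell g) iv) ≡ firstRow x (map g (map proj₂ iv))
    firstRowPart = begin
      concatMap (inversionCell (1 , x)) (map (shiftCell g) iv)
        ≡⟨ List.concatMap-map (inversionCell (1 , x)) (shiftCell g) iv ⟩
      concatMap (inversionCell (1 , x) ∘ shiftCell g) iv
        ≡⟨ cong concat (List.map-cong-local (All.map later iv-pos)) ⟩
      concatMap (cellOfFirst ∘ g ∘ proj₂) iv
        ≡⟨ List.concatMap-map cellOfFirst (g ∘ proj₂) iv ⟨
      concatMap cellOfFirst (map (g ∘ proj₂) iv)
        ≡⟨ cong (concatMap cellOfFirst) (List.map-∘ iv) ⟩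
      firstRow x (map g (map proj₂ iv)) ∎
      where
      later : ∀ {q} → 1 ≤ proj₁ q → inversionCell (1 , x) (shiftCell g q) ≡ cellOfFirst (g (proj₂ q))
      later {suc j , vj} _ = refl
    shiftedPart : concatMap (λ p → concatMap (inversionCell p) ((1 , x) ∷ map (shiftCell g) iv)) (map (shiftCell g) iv)
                ≡ map (shiftCell g) (rotheIndexed iv)
    shiftedPart = begin
      concatMap (λ p → concatMap (inversionCell p) ((1 , x) ∷ map (shiftCell g) iv)) (map (shiftCell g) iv)
        ≡⟨ List.concatMap-map (λ p → concatMap (inversionCell p) ((1 , x) ∷ map (shiftCell g) iv)) (shiftCell g) iv ⟩
      concatMap (λ p → concatMap (inversionCell (shiftCell g p)) (map (shiftCell g) iv)) iv
        ≡⟨ List.concatMap-cong (λ p → List.concatMap-map _ (shiftCell g) iv) iv ⟩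
      concatMap (λ p → concatMap (λ q → inversionCell (shiftCell g p) (shiftCell g q)) iv) iv
        ≡⟨ List.concatMap-cong (λ p → List.concatMap-cong (inversionCell-shift p) iv) iv ⟩
      concatMap (λ p → concatMap (map (shiftCell g) ∘ inversionCell p) iv) iv
        ≡⟨ List.concatMap-cong (λ p → List.map-concatMap (shiftCell g) (inversionCell p) iv) iv ⟨
      concatMap (map (shiftCell g) ∘ (λ p → concatMap (inversionCell p) iv)) iv
        ≡⟨ List.map-concatMap (shiftCell g) _ iv ⟨
      map (shiftCell g) (rotheIndexed iv) ∎

  rothe-∷-map : (x : ℕ) (v : List ℕ) → rothe (x ∷ map g v) ≡ firstRow x (map g v) ++ map (shiftCell g) (rothe v)
  rothe-∷-map x v = begin
    rotheIndexed (indexed (x ∷ map g v))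
      ≡⟨ cong rotheIndexed (indexed-∷-map g x v) ⟩
    rotheIndexed ((1 , x) ∷ map (shiftCell g) (indexed v))
      ≡⟨ rotheIndexed-shift x (indexed v) (indexed-positive v) ⟩
    firstRow x (map g (map proj₂ (indexed v))) ++ map (shiftCell g) (rothe v)
      ≡⟨ cong (λ v′ → firstRow x (map g v′) ++ map (shiftCell g) (rothe v)) (map-proj₂-indexed v) ⟩
    firstRow x (map g v) ++ map (shiftCell g) (rothe v) ∎
    where open ≡-Reasoning

rothe-∷ : (x : ℕ) (v : List ℕ) → rothe (x ∷ v) ≡ firstRow x v ++ map (shiftCell id) (rothe v)
rothe-∷ x v = begin
  rothe (x ∷ v)                                       ≡⟨ cong (λ v′ → rothe (x ∷ v′)) (List.map-id v) ⟨
  rothe (x ∷ map id v)                                ≡⟨ RotheShift.rothe-∷-map id id x v ⟩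
  firstRow x (map id v) ++ map (shiftCell id) (rothe v) ≡⟨ cong (λ v′ → firstRow x v′ ++ map (shiftCell id) (rothe v)) (List.map-id v) ⟩
  firstRow x v ++ map (shiftCell id) (rothe v)        ∎
  where open ≡-Reasoning

InRow1 : List Cell → Set
InRow1 = All (λ c → proj₁ c ≡ 1)

RowsPositive : List Cell → Set
RowsPositive = All (λ c → 1 ≤ proj₁ c)

rowCount-++ : ∀ D E r → rowCount (D ++ E) r ≡ rowCount D r + rowCount E r
rowCount-++ D E r = trans (cong length (filterᵇ-++ (λ c → proj₁ c ≡ᵇ r) D E)) (List.length-++ (filterᵇ (λ c → proj₁ c ≡ᵇ r) D))

rowCount-concatMap : {A : Set} (f : A → List Cell) (xs : List A) (r : ℕ) →
  rowCount (concatMap f xs) r ≡ sum (map (λ x → rowCount (f x) r) xs)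
rowCount-concatMap f [] r = refl
rowCount-concatMap f (x ∷ xs) r = trans (rowCount-++ (f x) _ r) (cong (rowCount (f x) r +_) (rowCount-concatMap f xs r))

rowCount-shift : ∀ g D r → rowCount (map (shiftCell g) D) (suc r) ≡ rowCount D r
rowCount-shift g D r = trans (cong length (filterᵇ-map (λ c → proj₁ c ≡ᵇ suc r) (shiftCell g) D))
  (List.length-map (shiftCell g) (filterᵇ (λ c → proj₁ c ≡ᵇ r) D))

rowCount-row0 : ∀ {D} → RowsPositive D → rowCount D 0 ≡ 0
rowCount-row0 D≥1 = cong length (filterᵇ-none _ (All.map (λ { {suc _ , _} _ → refl }) D≥1))

rowCount-InRow1-1 : ∀ {D} → InRow1 D → rowCount D 1 ≡ length D
rowCount-InRow1-1 D≡1 = cong length (filterᵇ-all _ (All.map (λ { refl → refl }) D≡1))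

rowCount-InRow1-2+ : ∀ {D} → InRow1 D → ∀ k → rowCount D (suc (suc k)) ≡ 0
rowCount-InRow1-2+ D≡1 k = cong length (filterᵇ-none _ (All.map (λ { refl → refl }) D≡1))

module _ {F : List Cell} (F≡1 : InRow1 F) (g : ℕ → ℕ) (D : List Cell) where

  rowCount-stacked-1 : RowsPositive D → rowCount (F ++ map (shiftCell g) D) 1 ≡ length F
  rowCount-stacked-1 D≥1 = begin
    rowCount (F ++ map (shiftCell g) D) 1             ≡⟨ rowCount-++ F _ 1 ⟩
    rowCount F 1 + rowCount (map (shiftCell g) D) 1   ≡⟨ cong₂ _+_ (rowCount-InRow1-1 F≡1) (rowCount-shift g D 0) ⟩
    length F + rowCount D 0                           ≡⟨ cong (length F +_) (rowCount-row0 D≥1) ⟩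
    length F + 0                                      ≡⟨ +-identityʳ _ ⟩
    length F                                          ∎
    where open ≡-Reasoning

  rowCount-stacked-2+ : ∀ k → rowCount (F ++ map (shiftCell g) D) (suc (suc k)) ≡ rowCount D (suc k)
  rowCount-stacked-2+ k = begin
    rowCount (F ++ map (shiftCell g) D) (suc (suc k))
      ≡⟨ rowCount-++ F _ (suc (suc k)) ⟩
    rowCount F (suc (suc k)) + rowCount (map (shiftCell g) D) (suc (suc k))
      ≡⟨ cong₂ _+_ (rowCount-InRow1-2+ F≡1 k) (rowCount-shift g D (suc k)) ⟩
    rowCount D (suc k) ∎
    where open ≡-Reasoning

map-range1-suc : (f f′ : ℕ → ℕ) (n : ℕ) → (∀ k → f (suc (suc k)) ≡ f′ (suc k)) →
  map f (range1 (suc n)) ≡ f 1 ∷ map f′ (range1 n)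
map-range1-suc f f′ n f≗f′ = begin
  map f (range1 (suc n))                 ≡⟨ cong (map f) (range1-suc n) ⟩
  f 1 ∷ map f (map suc (range1 n))       ≡⟨ cong (f 1 ∷_) (List.map-∘ (range1 n)) ⟨
  f 1 ∷ map (f ∘ suc) (map suc (upTo n)) ≡⟨ cong (f 1 ∷_) (List.map-∘ (upTo n)) ⟨
  f 1 ∷ map (f ∘ suc ∘ suc) (upTo n)     ≡⟨ cong (f 1 ∷_) (List.map-cong f≗f′ (upTo n)) ⟩
  f 1 ∷ map (f′ ∘ suc) (upTo n)          ≡⟨ cong (f 1 ∷_) (List.map-∘ (upTo n)) ⟩
  f 1 ∷ map f′ (range1 n)                ∎
  where open ≡-Reasoning

firstRow-InRow1 : ∀ x v → InRow1 (firstRow x v)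
firstRow-InRow1 x v = All-concatMap _ (All.tabulate {xs = v} λ {y} _ → cell y)
  where
  cell : ∀ y → InRow1 (if y <ᵇ x then (1 , y) ∷ [] else [])
  cell y with y <ᵇ x
  ... | true = refl ∷ []
  ... | false = []

length-firstRow : ∀ x v → length (firstRow x v) ≡ length (filterᵇ (_<ᵇ x) v)
length-firstRow x [] = refl
length-firstRow x (y ∷ v) with y <ᵇ x
... | true = cong suc (length-firstRow x v)
... | false = length-firstRow x v

memᵇ-firstRow : ∀ x y v → memᵇ (1 , y) (firstRow x v) ≡ any (λ z → (z <ᵇ x) ∧ (y ≡ᵇ z)) v
memᵇ-firstRow x y [] = refl
memᵇ-firstRow x y (z ∷ v) with z <ᵇ x
... | true = cong ((y ≡ᵇ z) ∨_) (memᵇ-firstRow x y v)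
... | false = memᵇ-firstRow x y v

rothe-cells : (v : List ℕ) → All (λ c → (1 ≤ proj₁ c) × (proj₂ c ∈ v)) (rothe v)
rothe-cells [] = []
rothe-cells (x ∷ v) = subst (All (λ c → (1 ≤ proj₁ c) × (proj₂ c ∈ x ∷ v))) (sym (rothe-∷ x v))
  (++⁺ (All-concatMap _ (All.tabulate {xs = v} cell))
       (map⁺ (All.map (λ { (r≥1 , c∈v) → m≤n⇒m≤1+n r≥1 , there c∈v }) (rothe-cells v))))
  where
  cell : ∀ {y} → y ∈ v → All (λ c → (1 ≤ proj₁ c) × (proj₂ c ∈ x ∷ v)) (if y <ᵇ x then (1 , y) ∷ [] else [])
  cell {y} y∈v with y <ᵇ x
  ... | true = (s≤s z≤n , there y∈v) ∷ []
  ... | false = []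

rothe-RowsPositive : ∀ v → RowsPositive (rothe v)
rothe-RowsPositive v = All.map proj₁ (rothe-cells v)

rowCounts-rothe : (v : List ℕ) → map (rowCount (rothe v)) (range1 (length v)) ≡ invcode v
rowCounts-rothe [] = refl
rowCounts-rothe (x ∷ v) = begin
  map (rowCount (rothe (x ∷ v))) (range1 (suc (length v)))
    ≡⟨ cong (λ D → map (rowCount D) (range1 (suc (length v)))) (rothe-∷ x v) ⟩
  map (rowCount R) (range1 (suc (length v)))
    ≡⟨ map-range1-suc (rowCount R) (rowCount (rothe v)) (length v)
         (rowCount-stacked-2+ (firstRow-InRow1 x v) id (rothe v)) ⟩
  rowCount R 1 ∷ map (rowCount (rothe v)) (range1 (length v))
    ≡⟨ cong₂ _∷_ (trans (rowCount-stacked-1 (firstRow-InRow1 x v) id (rothe v) (rothe-RowsPositive v))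
                        (length-firstRow x v))
                 (rowCounts-rothe v) ⟩
  invcode (x ∷ v) ∎
  where
  open ≡-Reasoning
  R : List Cell
  R = firstRow x v ++ map (shiftCell id) (rothe v)

-- The dark scan

usedColumn : List Cell → ℕ → Bool
usedColumn acc c = any (λ x → proj₂ x ≡ᵇ c) acc

isCandidate : ℕ → List Cell → Cell → Bool
isCandidate r acc x = (proj₁ x ≡ᵇ r) ∧ not (usedColumn acc (proj₂ x))

candidates : List Cell → ℕ → List Cell → List ℕ
candidates D r acc = map proj₂ (filterᵇ (isCandidate r acc) D)

scanStep : ℕ → List Cell → List ℕ → List Cell
scanStep r acc [] = acc
scanStep r acc (c ∷ cs) = (r , maxList (c ∷ cs)) ∷ acc

darkScan-∷ : ∀ D r rs acc → darkScan D (r ∷ rs) acc ≡ darkScan D rs (scanStep r acc (candidates D r acc))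
darkScan-∷ D r rs acc with candidates D r acc
... | [] = refl
... | c ∷ cs = refl

darkScan-++ : ∀ D rs rs′ acc → darkScan D (rs ++ rs′) acc ≡ darkScan D rs′ (darkScan D rs acc)
darkScan-++ D [] rs′ acc = refl
darkScan-++ D (r ∷ rs) rs′ acc = begin
  darkScan D (r ∷ rs ++ rs′) acc                  ≡⟨ darkScan-∷ D r (rs ++ rs′) acc ⟩
  darkScan D (rs ++ rs′) (scanStep r acc _)       ≡⟨ darkScan-++ D rs rs′ _ ⟩
  darkScan D rs′ (darkScan D rs (scanStep r acc _)) ≡⟨ cong (darkScan D rs′) (darkScan-∷ D r rs acc) ⟨
  darkScan D rs′ (darkScan D (r ∷ rs) acc)        ∎
  where open ≡-Reasoning

descending : ℕ → List ℕ
descending zero = []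
descending (suc k) = suc k ∷ descending k

reverse-range1 : ∀ k → reverse (range1 k) ≡ descending k
reverse-range1 k = begin
  reverse (map suc (upTo k)) ≡⟨ List.reverse-map suc (upTo k) ⟨
  map suc (reverse (upTo k)) ≡⟨ cong (map suc) (List.reverse-upTo k) ⟩
  map suc (downFrom k)       ≡⟨ map-suc-downFrom k ⟩
  descending k               ∎
  where
  open ≡-Reasoning
  map-suc-downFrom : ∀ k → map suc (downFrom k) ≡ descending k
  map-suc-downFrom zero = refl
  map-suc-downFrom (suc k) = cong (suc k ∷_) (map-suc-downFrom k)

descending-suc : ∀ k → descending (suc k) ≡ map suc (descending k) ++ 1 ∷ []
descending-suc zero = refl
descending-suc (suc k) = cong (suc (suc k) ∷_) (descending-suc k)

descending-positive : ∀ k → All (1 ≤_) (descending k)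
descending-positive zero = []
descending-positive (suc k) = s≤s z≤n ∷ descending-positive k

maxRow : List Cell → ℕ
maxRow D = maxList (map proj₁ D)

dark-descending : ∀ D → dark D ≡ darkScan D (descending (maxRow D)) []
dark-descending D = cong (λ rs → darkScan D rs []) (reverse-range1 (maxRow D))

maxList-upper : ∀ {x} xs → x ∈ xs → x ≤ maxList xs
maxList-upper (y ∷ xs) (here refl) = m≤m⊔n y (maxList xs)
maxList-upper (y ∷ xs) (there x∈xs) = ≤-trans (maxList-upper xs x∈xs) (m≤n⊔m y (maxList xs))

maxList-least : ∀ {K} xs → All (_≤ K) xs → maxList xs ≤ K
maxList-least [] [] = z≤n
maxList-least (y ∷ xs) (y≤K ∷ xs≤K) = ⊔-lub y≤K (maxList-least xs xs≤K)

maxList-∈ : ∀ c cs → maxList (c ∷ cs) ∈ c ∷ cs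
maxList-∈ c [] = here (⊔-identityʳ c)
maxList-∈ c (c′ ∷ cs) with ≤-total c (maxList (c′ ∷ cs))
... | inj₁ c≤m = subst (_∈ c ∷ c′ ∷ cs) (sym (m≤n⇒m⊔n≡n c≤m)) (there (maxList-∈ c′ cs))
... | inj₂ m≤c = here (m≥n⇒m⊔n≡m m≤c)

maxRow-upper : ∀ D → All (λ c → proj₁ c ≤ maxRow D) D
maxRow-upper D = All.tabulate (λ c∈D → maxList-upper (map proj₁ D) (∈-map⁺ proj₁ c∈D))

darkScan-emptyRows : ∀ D K → All (λ c → proj₁ c ≤ K) D → ∀ j acc →
  darkScan D (descending (j + K)) acc ≡ darkScan D (descending K) acc
darkScan-emptyRows D K D≤K zero acc = refl
darkScan-emptyRows D K D≤K (suc j) acc = begin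
  darkScan D (descending (suc j + K)) acc
    ≡⟨ darkScan-∷ D (suc (j + K)) (descending (j + K)) acc ⟩
  darkScan D (descending (j + K)) (scanStep (suc (j + K)) acc (map proj₂ (filterᵇ (isCandidate (suc (j + K)) acc) D)))
    ≡⟨ cong (λ cs → darkScan D (descending (j + K)) (scanStep (suc (j + K)) acc (map proj₂ cs)))
            (filterᵇ-none (isCandidate (suc (j + K)) acc) (All.map tooHigh D≤K)) ⟩
  darkScan D (descending (j + K)) acc
    ≡⟨ darkScan-emptyRows D K D≤K j acc ⟩
  darkScan D (descending K) acc ∎
  where
  open ≡-Reasoning
  tooHigh : ∀ {c : Cell} → proj₁ c ≤ K → isCandidate (suc (j + K)) acc c ≡ false
  tooHigh {c} c≤K rewrite reflects-false (≡ᵇ-reflects-≡ (proj₁ c) (suc (j + K)))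
                            (λ c≡ → <⇒≱ (s≤s (m≤n+m K j)) (subst (_≤ K) c≡ c≤K)) = refl

darkScan-All : (P : Cell → Set) → ∀ D rs acc → All P D → All P acc → All P (darkScan D rs acc)
darkScan-All P D [] acc PD Pacc = Pacc
darkScan-All P D (r ∷ rs) acc PD Pacc = subst (All P) (sym (darkScan-∷ D r rs acc))
  (darkScan-All P D rs _ PD (step (candidates D r acc) (candidatesP D PD)))
  where
  candidatesP : ∀ D → All P D → All (λ c → P (r , c)) (candidates D r acc)
  candidatesP [] [] = []
  candidatesP (x ∷ D) (Px ∷ PD) with isCandidate r acc x in eq
  ... | true = subst (λ r′ → P (r′ , proj₂ x)) (true-reflects (≡ᵇ-reflects-≡ _ r) (proj₁ (∧-true eq))) Px ∷ candidatesP D PD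
  ... | false = candidatesP D PD
  step : ∀ cs → All (λ c → P (r , c)) cs → All P (scanStep r acc cs)
  step [] _ = Pacc
  step (c ∷ cs) Pcs = All.lookup Pcs (maxList-∈ c cs) ∷ Pacc

dark-All : (P : Cell → Set) → ∀ D → All P D → All P (dark D)
dark-All P D PD = darkScan-All P D (reverse (range1 (maxRow D))) [] PD []

-- Snow diagrams

column : ℕ → List ℕ → List Cell
column c rs = map (λ r → (r , c)) rs

snowCells : List Cell → Cell → List Cell
snowCells R (r , c) = column c (filterᵇ (λ r′ → not (memᵇ (r′ , c) R)) (range1 (r ∸ 1)))

snowDiagram : List Cell → List Cell
snowDiagram R = R ++ concatMap (snowCells R) (dark R)

snowCells-RowsPositive : ∀ R x → RowsPositive (snowCells R x)
snowCells-RowsPositive R (r , c) = map⁺ (filter⁺ _ (map⁺ {xs = upTo (r ∸ 1)} (All.tabulate λ _ → s≤s z≤n)))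

module Stacked (g : ℕ → ℕ) (g-< : ∀ {y z} → y < z → g y < g z)
                 {F : List Cell} (F≡1 : InRow1 F) (D : List Cell) where
  open StrictlyMonotone g g-<

  stacked : List Cell
  stacked = F ++ map (shiftCell g) D

  usedColumn-shift : ∀ acc c → usedColumn (map (shiftCell g) acc) (g c) ≡ usedColumn acc c
  usedColumn-shift acc c = trans (any-map (λ x → proj₂ x ≡ᵇ g c) (shiftCell g) acc)
    (any-cong (All.tabulate {xs = acc} (λ {x} _ → g-≡ᵇ (proj₂ x) c)))

  candidates-shift : ∀ r → 1 ≤ r → ∀ acc →
    candidates stacked (suc r) (map (shiftCell g) acc) ≡ map g (candidates D r acc)
  candidates-shift (suc r) _ acc = begin
    map proj₂ (filterᵇ p (F ++ map (shiftCell g) D))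
      ≡⟨ cong (map proj₂) (filterᵇ-++ p F _) ⟩
    map proj₂ (filterᵇ p F ++ filterᵇ p (map (shiftCell g) D))
      ≡⟨ cong (λ cs → map proj₂ (cs ++ filterᵇ p (map (shiftCell g) D))) (filterᵇ-none p (All.map (λ { refl → refl }) F≡1)) ⟩
    map proj₂ (filterᵇ p (map (shiftCell g) D))
      ≡⟨ cong (map proj₂) (filterᵇ-map p (shiftCell g) D) ⟩
    map proj₂ (map (shiftCell g) (filterᵇ (p ∘ shiftCell g) D))
      ≡⟨ cong (map proj₂ ∘ map (shiftCell g)) (filterᵇ-cong (All.tabulate {xs = D} λ {x} _ → p-shift x)) ⟩
    map proj₂ (map (shiftCell g) (filterᵇ (isCandidate (suc r) acc) D))
      ≡⟨ List.map-∘ (filterᵇ (isCandidate (suc r) acc) D) ⟨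
    map (g ∘ proj₂) (filterᵇ (isCandidate (suc r) acc) D)
      ≡⟨ List.map-∘ (filterᵇ (isCandidate (suc r) acc) D) ⟩
    map g (candidates D (suc r) acc) ∎
    where
    open ≡-Reasoning
    p = isCandidate (suc (suc r)) (map (shiftCell g) acc)
    p-shift : ∀ x → p (shiftCell g x) ≡ isCandidate (suc r) acc x
    p-shift x = cong (λ b → (proj₁ x ≡ᵇ suc r) ∧ not b) (usedColumn-shift acc (proj₂ x))

  scanStep-shift : ∀ r acc cs → scanStep (suc r) (map (shiftCell g) acc) (map g cs) ≡ map (shiftCell g) (scanStep r acc cs)
  scanStep-shift r acc [] = refl
  scanStep-shift r acc (c ∷ cs) = cong (λ m → (suc r , m) ∷ map (shiftCell g) acc) (maxList-map c cs)

  darkScan-shift : ∀ rs → All (1 ≤_) rs → ∀ acc →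
    darkScan stacked (map suc rs) (map (shiftCell g) acc) ≡ map (shiftCell g) (darkScan D rs acc)
  darkScan-shift [] [] acc = refl
  darkScan-shift (r ∷ rs) (r≥1 ∷ rs≥1) acc = begin
    darkScan stacked (suc r ∷ map suc rs) (map (shiftCell g) acc)
      ≡⟨ darkScan-∷ stacked (suc r) _ _ ⟩
    darkScan stacked (map suc rs) (scanStep (suc r) (map (shiftCell g) acc) (candidates stacked (suc r) (map (shiftCell g) acc)))
      ≡⟨ cong (darkScan stacked (map suc rs) ∘ scanStep (suc r) (map (shiftCell g) acc)) (candidates-shift r r≥1 acc) ⟩
    darkScan stacked (map suc rs) (scanStep (suc r) (map (shiftCell g) acc) (map g (candidates D r acc)))
      ≡⟨ cong (darkScan stacked (map suc rs)) (scanStep-shift r acc _) ⟩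
    darkScan stacked (map suc rs) (map (shiftCell g) (scanStep r acc (candidates D r acc)))
      ≡⟨ darkScan-shift rs rs≥1 _ ⟩
    map (shiftCell g) (darkScan D rs (scanStep r acc (candidates D r acc)))
      ≡⟨ cong (map (shiftCell g)) (darkScan-∷ D r rs acc) ⟨
    map (shiftCell g) (darkScan D (r ∷ rs) acc) ∎
    where open ≡-Reasoning

  maxRow-stacked : maxRow stacked ≤ suc (maxRow D)
  maxRow-stacked = maxList-least (map proj₁ stacked) (map⁺ (++⁺ (All.map (λ { refl → s≤s z≤n }) F≡1)
    (map⁺ (All.map s≤s (maxRow-upper D)))))

  scanStep-adds : ∀ r acc cs → ∃ λ E → All (λ c → proj₁ c ≡ r) E × scanStep r acc cs ≡ E ++ acc
  scanStep-adds r acc [] = [] , [] , refl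
  scanStep-adds r acc (c ∷ cs) = _ ∷ [] , refl ∷ [] , refl

  dark-stacked : ∃ λ E → InRow1 E × dark stacked ≡ E ++ map (shiftCell g) (dark D)
  dark-stacked with scanStep-adds 1 (map (shiftCell g) (dark D)) (candidates stacked 1 (map (shiftCell g) (dark D)))
  ... | E , E≡1 , step≡ = E , E≡1 , (begin
    dark stacked
      ≡⟨ dark-descending stacked ⟩
    darkScan stacked (descending (maxRow stacked)) []
      ≡⟨ darkScan-emptyRows stacked (maxRow stacked) (maxRow-upper stacked) (suc M ∸ maxRow stacked) [] ⟨
    darkScan stacked (descending (suc M ∸ maxRow stacked + maxRow stacked)) []
      ≡⟨ cong (λ k → darkScan stacked (descending k) []) (m∸n+n≡m maxRow-stacked) ⟩
    darkScan stacked (descending (suc M)) []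
      ≡⟨ cong (λ rs → darkScan stacked rs []) (descending-suc M) ⟩
    darkScan stacked (map suc (descending M) ++ 1 ∷ []) []
      ≡⟨ darkScan-++ stacked (map suc (descending M)) (1 ∷ []) [] ⟩
    darkScan stacked (1 ∷ []) (darkScan stacked (map suc (descending M)) (map (shiftCell g) []))
      ≡⟨ cong (darkScan stacked (1 ∷ [])) (darkScan-shift (descending M) (descending-positive M) []) ⟩
    darkScan stacked (1 ∷ []) (map (shiftCell g) (darkScan D (descending M) []))
      ≡⟨ cong (darkScan stacked (1 ∷ []) ∘ map (shiftCell g)) (dark-descending D) ⟨
    darkScan stacked (1 ∷ []) (map (shiftCell g) (dark D))
      ≡⟨ darkScan-∷ stacked 1 [] _ ⟩
    scanStep 1 (map (shiftCell g) (dark D)) (candidates stacked 1 (map (shiftCell g) (dark D)))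
      ≡⟨ step≡ ⟩
    E ++ map (shiftCell g) (dark D) ∎)
    where
    open ≡-Reasoning
    M = maxRow D

  memᵇ-stacked-2+ : ∀ k c → memᵇ (suc (suc k) , g c) stacked ≡ memᵇ (suc k , c) D
  memᵇ-stacked-2+ k c = begin
    any (cell≡ᵇ (suc (suc k) , g c)) (F ++ map (shiftCell g) D)
      ≡⟨ any-++ _ F _ ⟩
    any (cell≡ᵇ (suc (suc k) , g c)) F ∨ any (cell≡ᵇ (suc (suc k) , g c)) (map (shiftCell g) D)
      ≡⟨ cong₂ _∨_ (any-none _ (All.map (λ { refl → refl }) F≡1)) (any-map _ (shiftCell g) D) ⟩
    any (cell≡ᵇ (suc (suc k) , g c) ∘ shiftCell g) D
      ≡⟨ any-cong (All.tabulate {xs = D} λ {x} _ → cong ((suc k ≡ᵇ proj₁ x) ∧_) (g-≡ᵇ c (proj₂ x))) ⟩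
    memᵇ (suc k , c) D ∎
    where open ≡-Reasoning

  memᵇ-stacked-1 : RowsPositive D → ∀ y → memᵇ (1 , y) stacked ≡ memᵇ (1 , y) F
  memᵇ-stacked-1 D≥1 y = begin
    any (cell≡ᵇ (1 , y)) (F ++ map (shiftCell g) D)
      ≡⟨ any-++ _ F _ ⟩
    memᵇ (1 , y) F ∨ any (cell≡ᵇ (1 , y)) (map (shiftCell g) D)
      ≡⟨ cong (memᵇ (1 , y) F ∨_) (trans (any-map _ (shiftCell g) D) (any-none _ (All.map (λ { {suc _ , _} _ → refl }) D≥1))) ⟩
    memᵇ (1 , y) F ∨ false
      ≡⟨ ∨-identityʳ _ ⟩
    memᵇ (1 , y) F ∎
    where open ≡-Reasoning

  topCell : ℕ → List Cell
  topCell c = if not (memᵇ (1 , g c) stacked) then (1 , g c) ∷ [] else []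

  topCell-InRow1 : ∀ c → InRow1 (topCell c)
  topCell-InRow1 c with not (memᵇ (1 , g c) stacked)
  ... | true = refl ∷ []
  ... | false = []

  snowCells-stacked : ∀ r c → snowCells stacked (shiftCell g (suc r , c)) ≡ topCell c ++ map (shiftCell g) (snowCells D (suc r , c))
  snowCells-stacked r c = begin
    column (g c) (filterᵇ P (range1 (suc r)))
      ≡⟨ cong (column (g c) ∘ filterᵇ P) (range1-suc r) ⟩
    column (g c) (filterᵇ P (1 ∷ map suc (range1 r)))
      ≡⟨ cong (column (g c)) (filterᵇ-∷ P 1 _) ⟩
    column (g c) ((if P 1 then 1 ∷ [] else []) ++ filterᵇ P (map suc (range1 r)))
      ≡⟨ List.map-++ _ (if P 1 then 1 ∷ [] else []) _ ⟩
    column (g c) (if P 1 then 1 ∷ [] else []) ++ column (g c) (filterᵇ P (map suc (range1 r)))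
      ≡⟨ cong₂ _++_ (map-if-singleton _ (P 1) 1) lowerRows ⟩
    topCell c ++ map (shiftCell g) (snowCells D (suc r , c)) ∎
    where
    open ≡-Reasoning
    P Q : ℕ → Bool
    P r′ = not (memᵇ (r′ , g c) stacked)
    Q r′ = not (memᵇ (r′ , c) D)
    lowerRows : column (g c) (filterᵇ P (map suc (range1 r))) ≡ map (shiftCell g) (column c (filterᵇ Q (range1 r)))
    lowerRows = begin
      column (g c) (filterᵇ P (map suc (range1 r)))
        ≡⟨ cong (column (g c)) (filterᵇ-map P suc (range1 r)) ⟩
      column (g c) (map suc (filterᵇ (P ∘ suc) (range1 r)))
        ≡⟨ cong (column (g c) ∘ map suc)
                (filterᵇ-cong (map⁺ {xs = upTo r} (All.tabulate λ {k} _ → cong not (memᵇ-stacked-2+ k c)))) ⟩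
      column (g c) (map suc (filterᵇ Q (range1 r)))
        ≡⟨ List.map-∘ (filterᵇ Q (range1 r)) ⟨
      map (shiftCell g ∘ (λ r′ → (r′ , c))) (filterᵇ Q (range1 r))
        ≡⟨ List.map-∘ (filterᵇ Q (range1 r)) ⟩
      map (shiftCell g) (column c (filterᵇ Q (range1 r))) ∎

  snowCells-dark-stacked : concatMap (snowCells stacked) (dark stacked) ≡ concatMap (snowCells stacked ∘ shiftCell g) (dark D)
  snowCells-dark-stacked with dark-stacked
  ... | E , E≡1 , dark≡ = begin
    concatMap (snowCells stacked) (dark stacked)
      ≡⟨ cong (concatMap (snowCells stacked)) dark≡ ⟩
    concatMap (snowCells stacked) (E ++ map (shiftCell g) (dark D))
      ≡⟨ List.concatMap-++ (snowCells stacked) E _ ⟩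
    concatMap (snowCells stacked) E ++ concatMap (snowCells stacked) (map (shiftCell g) (dark D))
      ≡⟨ cong₂ _++_ (concatMap-[] (snowCells stacked) (All.map (λ { {_ , _} refl → refl }) E≡1))
                    (List.concatMap-map (snowCells stacked) (shiftCell g) (dark D)) ⟩
    concatMap (snowCells stacked ∘ shiftCell g) (dark D) ∎
    where open ≡-Reasoning

  module _ (D≥1 : RowsPositive D) where

    private
      darkD≥1 : RowsPositive (dark D)
      darkD≥1 = dark-All _ D D≥1

      snowRowCount : ℕ → ℕ
      snowRowCount r = rowCount (concatMap (snowCells stacked ∘ shiftCell g) (dark D)) r

    rowCount-snowDiagram-stacked-1 :
      rowCount (snowDiagram stacked) 1 ≡ length F + sum (map (length ∘ topCell ∘ proj₂) (dark D))
    rowCount-snowDiagram-stacked-1 = begin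
      rowCount (stacked ++ concatMap (snowCells stacked) (dark stacked)) 1
        ≡⟨ rowCount-++ stacked _ 1 ⟩
      rowCount stacked 1 + rowCount (concatMap (snowCells stacked) (dark stacked)) 1
        ≡⟨ cong₂ _+_ (rowCount-stacked-1 F≡1 g D D≥1) (cong (λ X → rowCount X 1) snowCells-dark-stacked) ⟩
      length F + snowRowCount 1
        ≡⟨ cong (length F +_) (trans (rowCount-concatMap _ (dark D) 1) (sum-cong (All.map perCell darkD≥1))) ⟩
      length F + sum (map (length ∘ topCell ∘ proj₂) (dark D)) ∎
      where
      open ≡-Reasoning
      perCell : ∀ {x} → 1 ≤ proj₁ x → rowCount (snowCells stacked (shiftCell g x)) 1 ≡ length (topCell (proj₂ x))
      perCell {suc r , c} _ = trans (cong (λ X → rowCount X 1) (snowCells-stacked r c))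
        (rowCount-stacked-1 (topCell-InRow1 c) g (snowCells D (suc r , c)) (snowCells-RowsPositive D (suc r , c)))

    rowCount-snowDiagram-stacked-2+ : ∀ k → rowCount (snowDiagram stacked) (suc (suc k)) ≡ rowCount (snowDiagram D) (suc k)
    rowCount-snowDiagram-stacked-2+ k = begin
      rowCount (stacked ++ concatMap (snowCells stacked) (dark stacked)) (suc (suc k))
        ≡⟨ rowCount-++ stacked _ (suc (suc k)) ⟩
      rowCount stacked (suc (suc k)) + rowCount (concatMap (snowCells stacked) (dark stacked)) (suc (suc k))
        ≡⟨ cong₂ _+_ (rowCount-stacked-2+ F≡1 g D k) (cong (λ X → rowCount X (suc (suc k))) snowCells-dark-stacked) ⟩
      rowCount D (suc k) + snowRowCount (suc (suc k))
        ≡⟨ cong (rowCount D (suc k) +_) (begin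
             snowRowCount (suc (suc k))
               ≡⟨ rowCount-concatMap _ (dark D) (suc (suc k)) ⟩
             sum (map (λ x → rowCount (snowCells stacked (shiftCell g x)) (suc (suc k))) (dark D))
               ≡⟨ sum-cong (All.map perCell darkD≥1) ⟩
             sum (map (λ x → rowCount (snowCells D x) (suc k)) (dark D))
               ≡⟨ rowCount-concatMap (snowCells D) (dark D) (suc k) ⟨
             rowCount (concatMap (snowCells D) (dark D)) (suc k) ∎) ⟩
      rowCount D (suc k) + rowCount (concatMap (snowCells D) (dark D)) (suc k)
        ≡⟨ rowCount-++ D _ (suc k) ⟨
      rowCount (snowDiagram D) (suc k) ∎
      where
      open ≡-Reasoning
      perCell : ∀ {x} → 1 ≤ proj₁ x → rowCount (snowCells stacked (shiftCell g x)) (suc (suc k)) ≡ rowCount (snowCells D x) (suc k)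
      perCell {suc r , c} _ = trans (cong (λ X → rowCount X (suc (suc k))) (snowCells-stacked r c))
        (rowCount-stacked-2+ (topCell-InRow1 c) g (snowCells D (suc r , c)) k)

-- w = (a , u) is the list suc a ∷ map (liftAbove a) u.

liftAbove : ℕ → ℕ → ℕ
liftAbove a v = if v ≤ᵇ a then v else suc v

module _ (a : ℕ) where

  liftAbove-≤ : ∀ {v} → v ≤ a → liftAbove a v ≡ v
  liftAbove-≤ {v} v≤a rewrite reflects-true (≤ᵇ-reflects-≤ v a) v≤a = refl

  liftAbove-> : ∀ {v} → a < v → liftAbove a v ≡ suc v
  liftAbove-> {v} a<v rewrite reflects-false (≤ᵇ-reflects-≤ v a) (<⇒≱ a<v) = refl

  liftAbove-< : ∀ {y z} → y < z → liftAbove a y < liftAbove a z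
  liftAbove-< {y} {z} y<z with y ≤? a | z ≤? a
  ... | yes y≤a | yes z≤a rewrite liftAbove-≤ y≤a | liftAbove-≤ z≤a = y<z
  ... | yes y≤a | no z≰a rewrite liftAbove-≤ y≤a | liftAbove-> (≰⇒> z≰a) = m<n⇒m<1+n y<z
  ... | no y≰a | yes z≤a = ⊥-elim (y≰a (≤-trans (<⇒≤ y<z) z≤a))
  ... | no y≰a | no z≰a rewrite liftAbove-> (≰⇒> y≰a) | liftAbove-> (≰⇒> z≰a) = s≤s y<z

module LiftedRothe (a : ℕ) (u : List ℕ) where
  private
    g : ℕ → ℕ
    g = liftAbove a
  open Stacked g (liftAbove-< a) (firstRow-InRow1 (suc a) (map g u)) (rothe u)

  rothe-lift : rothe (suc a ∷ map g u) ≡ stacked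
  rothe-lift = RotheShift.rothe-∷-map g (liftAbove-< a) (suc a) u

  memᵇ-row1 : ∀ {c} → c ∈ u → memᵇ (1 , g c) stacked ≡ not (a <ᵇ c)
  memᵇ-row1 {c} c∈u = begin
    memᵇ (1 , g c) stacked
      ≡⟨ memᵇ-stacked-1 (rothe-RowsPositive u) (g c) ⟩
    memᵇ (1 , g c) (firstRow (suc a) (map g u))
      ≡⟨ memᵇ-firstRow (suc a) (g c) (map g u) ⟩
    any (λ z → (z <ᵇ suc a) ∧ (g c ≡ᵇ z)) (map g u)
      ≡⟨ byCases (c ≤? a) ⟩
    not (a <ᵇ c) ∎
    where
    open ≡-Reasoning
    byCases : Dec (c ≤ a) → any (λ z → (z <ᵇ suc a) ∧ (g c ≡ᵇ z)) (map g u) ≡ not (a <ᵇ c)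
    byCases (yes c≤a) rewrite reflects-false (<ᵇ-reflects-< a c) (≤⇒≯ c≤a) =
      any-∈ _ (∈-map⁺ g c∈u) (begin
        (g c <ᵇ suc a) ∧ (g c ≡ᵇ g c) ≡⟨ cong (λ y → (y <ᵇ suc a) ∧ (y ≡ᵇ y)) (liftAbove-≤ a c≤a) ⟩
        (c <ᵇ suc a) ∧ (c ≡ᵇ c)       ≡⟨ cong₂ _∧_ (reflects-true (<ᵇ-reflects-< c (suc a)) (s≤s c≤a)) (≡ᵇ-refl c) ⟩
        true                          ∎)
    byCases (no c≰a) rewrite reflects-true (<ᵇ-reflects-< a c) (≰⇒> c≰a) =
      any-none _ (All.tabulate {xs = map g u} λ {z} _ → notBelow z)
      where
      notBelow : ∀ z → (z <ᵇ suc a) ∧ (g c ≡ᵇ z) ≡ false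
      notBelow z with z <ᵇ suc a in z<ᵇ
      ... | false = refl
      ... | true = reflects-false (≡ᵇ-reflects-≡ (g c) z) λ gc≡z →
        <⇒≱ (true-reflects (<ᵇ-reflects-< z (suc a)) z<ᵇ)
            (subst (suc a ≤_) (trans (sym (liftAbove-> a (≰⇒> c≰a))) gc≡z) (m≤n⇒m≤1+n (≰⇒> c≰a)))

  length-topCell : ∀ {c} → c ∈ u → length (topCell c) ≡ (if a <ᵇ c then 1 else 0)
  length-topCell {c} c∈u rewrite memᵇ-row1 c∈u with a <ᵇ c
  ... | true = refl
  ... | false = refl

  rajcode-lift : length (filterᵇ (_<ᵇ suc a) (map g u)) ≡ a →
    rajcode (suc a ∷ map g u) ≡ (a + d a u) ∷ rajcode u
  rajcode-lift firstRow≡a = begin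
    map (rowCount (snow (suc a ∷ map g u))) (range1 (suc (length (map g u))))
      ≡⟨ cong₂ (λ D k → map (rowCount (snowDiagram D)) (range1 (suc k))) rothe-lift (List.length-map g u) ⟩
    map (rowCount (snowDiagram stacked)) (range1 (suc (length u)))
      ≡⟨ map-range1-suc _ (rowCount (snow u)) (length u) (rowCount-snowDiagram-stacked-2+ (rothe-RowsPositive u)) ⟩
    rowCount (snowDiagram stacked) 1 ∷ rajcode u
      ≡⟨ cong (_∷ rajcode u) (rowCount-snowDiagram-stacked-1 (rothe-RowsPositive u)) ⟩
    length (firstRow (suc a) (map g u)) + sum (map (length ∘ topCell ∘ proj₂) (dark (rothe u))) ∷ rajcode u
      ≡⟨ cong₂ (λ m n → m + n ∷ rajcode u) (trans (length-firstRow (suc a) (map g u)) firstRow≡a) darkCount ⟩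
    (a + d a u) ∷ rajcode u ∎
    where
    open ≡-Reasoning
    darkCount : sum (map (length ∘ topCell ∘ proj₂) (dark (rothe u))) ≡ d a u
    darkCount = trans (sum-cong (All.map (length-topCell ∘ proj₂) (dark-All _ (rothe u) (rothe-cells u))))
                      (sym (length-filterᵇ≡sum (λ x → a <ᵇ proj₂ x) (dark (rothe u))))

·-identityʳ : ∀ m → m · [] ≡ m
·-identityʳ [] = refl
·-identityʳ (x ∷ m) = refl

∷·var-1 : ∀ x m → (x ∷ m) · var 1 ≡ suc x ∷ m
∷·var-1 x m = cong₂ _∷_ (+-comm x 1) (·-identityʳ m)

∷·var-2+ : ∀ x m p → (x ∷ m) · var (suc (suc p)) ≡ x ∷ (m · var (suc p))
∷·var-2+ x m p = cong (_∷ m · var (suc p)) (+-identityʳ x)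

sum-· : ∀ α β → sum (α · β) ≡ sum α + sum β
sum-· [] β = refl
sum-· (a ∷ α) [] = sym (+-identityʳ (a + sum α))
sum-· (a ∷ α) (b ∷ β) rewrite sum-· α β = interchange a b (sum α) (sum β)

sum-var : ∀ p → sum (var (suc p)) ≡ 1
sum-var zero = refl
sum-var (suc p) = sum-var p

sum-·var : ∀ m p → sum (m · var (suc p)) ≡ suc (sum m)
sum-·var m p = trans (sum-· m (var (suc p))) (trans (cong (sum m +_) (sum-var p)) (+-comm (sum m) 1))

divᵇ⇒sum-≤ : ∀ α β → divᵇ α β ≡ true → sum α ≤ sum β
divᵇ⇒sum-≤ [] β _ = z≤n
divᵇ⇒sum-≤ (a ∷ α) [] α∣β with ∧-true {a ≡ᵇ 0} α∣β
... | a≡0 , α∣[] rewrite true-reflects (≡ᵇ-reflects-≡ a 0) a≡0 = divᵇ⇒sum-≤ α [] α∣[]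
divᵇ⇒sum-≤ (a ∷ α) (b ∷ β) α∣β with ∧-true {a ≤ᵇ b} α∣β
... | a≤b , α∣β′ = +-mono-≤ (true-reflects (≤ᵇ-reflects-≤ a b) a≤b) (divᵇ⇒sum-≤ α β α∣β′)

-- IR sequences

largestIndex : Monomial → Monomial → ℕ
largestIndex t m = largestDividing t m (range1 (length t)) 0

multiplyBy : Monomial → ℕ → Monomial
multiplyBy m zero = m
multiplyBy m (suc p) = m · var (suc p)

IRstep≡multiplyBy : ∀ t m → IRstep t m ≡ multiplyBy m (largestIndex t m)
IRstep≡multiplyBy t m with largestIndex t m
... | zero = refl
... | suc p = refl

_orElse_ : ℕ → ℕ → ℕ
zero orElse b = b
suc p orElse b = suc p

largestDividing-default : ∀ t m U b →
  largestDividing t m (map suc U) b ≡ largestDividing t m (map suc U) 0 orElse b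
largestDividing-default t m [] b = refl
largestDividing-default t m (k ∷ U) b
  rewrite largestDividing-default t m U (if divᵇ (m · var (suc k)) t then suc k else b)
        | largestDividing-default t m U (if divᵇ (m · var (suc k)) t then suc k else 0)
  with largestDividing t m (map suc U) 0
... | suc q = refl
... | zero with divᵇ (m · var (suc k)) t
...   | true = refl
...   | false = refl

largestDividing-divides : ∀ t m ps b →
  largestDividing t m ps b ≡ b ⊎ divᵇ (m · var (largestDividing t m ps b)) t ≡ true
largestDividing-divides t m [] b = inj₁ refl
largestDividing-divides t m (p ∷ ps) b with divᵇ (m · var p) t in m·xp∣t
... | false = largestDividing-divides t m ps b
... | true with largestDividing-divides t m ps p
...   | inj₁ ≡p = inj₂ (subst (λ q → divᵇ (m · var q) t ≡ true) (sym ≡p) m·xp∣t)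
...   | inj₂ ∣t = inj₂ ∣t

module ConsStep (x y : ℕ) (T m : Monomial) (x≤y : x ≤ y) where

  tailOr : ℕ → ℕ → ℕ
  tailOr zero b = b
  tailOr (suc p) b = suc (suc p)

  raiseHead : Bool
  raiseHead = (suc x ≤ᵇ y) ∧ divᵇ m T

  divᵇ-∷·var-2+ : ∀ k → divᵇ ((x ∷ m) · var (suc (suc k))) (y ∷ T) ≡ divᵇ (m · var (suc k)) T
  divᵇ-∷·var-2+ k rewrite +-identityʳ x | reflects-true (≤ᵇ-reflects-≤ x y) x≤y = refl

  largestDividing-∷ : ∀ U b →
    largestDividing (y ∷ T) (x ∷ m) (map suc (map suc U)) b ≡ tailOr (largestDividing T m (map suc U) 0) b
  largestDividing-∷ [] b = refl
  largestDividing-∷ (k ∷ U) b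
    rewrite divᵇ-∷·var-2+ k
          | largestDividing-∷ U (if divᵇ (m · var (suc k)) T then suc (suc k) else b)
          | largestDividing-default T m U (if divᵇ (m · var (suc k)) T then suc k else 0)
    with largestDividing T m (map suc U) 0
  ... | suc q = refl
  ... | zero with divᵇ (m · var (suc k)) T
  ...   | true = refl
  ...   | false = refl

  largestIndex-∷ : largestIndex (y ∷ T) (x ∷ m) ≡ tailOr (largestIndex T m) (if raiseHead then 1 else 0)
  largestIndex-∷ = begin
    largestDividing (y ∷ T) (x ∷ m) (range1 (suc (length T))) 0
      ≡⟨ cong (λ ps → largestDividing (y ∷ T) (x ∷ m) ps 0) (range1-suc (length T)) ⟩
    largestDividing (y ∷ T) (x ∷ m) (map suc (range1 (length T))) (if divᵇ ((x ∷ m) · var 1) (y ∷ T) then 1 else 0)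
      ≡⟨ cong (λ n → largestDividing (y ∷ T) (x ∷ m) (map suc (range1 (length T))) (if divᵇ n (y ∷ T) then 1 else 0))
              (∷·var-1 x m) ⟩
    largestDividing (y ∷ T) (x ∷ m) (map suc (range1 (length T))) (if raiseHead then 1 else 0)
      ≡⟨ largestDividing-∷ (upTo (length T)) _ ⟩
    tailOr (largestIndex T m) (if raiseHead then 1 else 0) ∎
    where open ≡-Reasoning

  afterStep : ℕ → Monomial
  afterStep zero = if raiseHead then suc x ∷ m else x ∷ m
  afterStep (suc p) = x ∷ IRstep T m

  -- The step only touches x₁ when no variable of the tail can be raised.
  IRstep-∷ : IRstep (y ∷ T) (x ∷ m) ≡ afterStep (largestIndex T m)
  IRstep-∷ = trans (IRstep≡multiplyBy (y ∷ T) (x ∷ m))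
    (trans (cong (multiplyBy (x ∷ m)) largestIndex-∷) (byIndex (largestIndex T m) refl))
    where
    byIndex : ∀ l → largestIndex T m ≡ l → multiplyBy (x ∷ m) (tailOr l (if raiseHead then 1 else 0)) ≡ afterStep l
    byIndex zero _ with raiseHead
    ... | true = ∷·var-1 x m
    ... | false = refl
    byIndex (suc p) l≡ = trans (∷·var-2+ x m p)
      (cong (x ∷_) (sym (trans (IRstep≡multiplyBy T m) (cong (multiplyBy m) l≡))))

record Divides (m T : Monomial) : Set where
  constructor _,_
  field
    divides : divᵇ m T ≡ true
    sameLength : length m ≡ length T
open Divides

Divides-∷ : ∀ {x y m T} → Divides (x ∷ m) (y ∷ T) → x ≤ y × Divides m T
Divides-∷ {x} {y} (x∷m∣y∷T , len≡) with ∧-true {x ≤ᵇ y} x∷m∣y∷T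
... | x≤ᵇy , m∣T = true-reflects (≤ᵇ-reflects-≤ x y) x≤ᵇy , (m∣T , suc-injective len≡)

largestIndex-nonzero : ∀ T m → Divides m T → sum m < sum T → ∃ λ p → largestIndex T m ≡ suc p
largestIndex-nonzero [] [] _ ()
largestIndex-nonzero (y ∷ T) (x ∷ m) x∷m∣y∷T sum< with Divides-∷ x∷m∣y∷T
... | x≤y , m∣T = byTail (largestIndex T m) refl
  where
  open ConsStep x y T m x≤y
  byTail : ∀ l → largestIndex T m ≡ l → ∃ λ p → largestIndex (y ∷ T) (x ∷ m) ≡ suc p
  byTail (suc p) l≡ = suc p , trans largestIndex-∷ (cong (λ l → tailOr l (if raiseHead then 1 else 0)) l≡)
  byTail zero l≡ = 0 , trans largestIndex-∷ (trans (cong (λ l → tailOr l (if raiseHead then 1 else 0)) l≡) headRaised)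
    where
    -- With the tail saturated, the deficit sum m < sum T sits in the first entry.
    x<y : x < y
    x<y with m≤n⇒m<n∨m≡n x≤y
    ... | inj₁ x<y = x<y
    ... | inj₂ refl with largestIndex-nonzero T m m∣T (+-cancelˡ-< x (sum m) (sum T) sum<)
    ...   | p , l≡suc = ⊥-elim (0≢1+n (trans (sym l≡) l≡suc))
    headRaised : (if raiseHead then 1 else 0) ≡ 1
    headRaised rewrite reflects-true (≤ᵇ-reflects-≤ (suc x) y) x<y | divides m∣T = refl

largestIndex-zero : ∀ T m → Divides m T → sum m ≡ sum T → largestIndex T m ≡ 0
largestIndex-zero T m m∣T sum≡ with largestDividing-divides T m (range1 (length T)) 0
... | inj₁ l≡0 = l≡0
... | inj₂ m·x∣T with largestIndex T m
...   | zero = refl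
...   | suc p = ⊥-elim (<-irrefl sum≡ (subst (_≤ sum T) (sum-·var m p) (divᵇ⇒sum-≤ (m · var (suc p)) T m·x∣T)))

IRstep-Divides : ∀ T m → Divides m T → Divides (IRstep T m) T
IRstep-Divides [] [] m∣T = m∣T
IRstep-Divides (y ∷ T) (x ∷ m) x∷m∣y∷T with Divides-∷ x∷m∣y∷T
... | x≤y , m∣T = subst (λ n → Divides n (y ∷ T)) (sym IRstep-∷) (byIndex (largestIndex T m))
  where
  open ConsStep x y T m x≤y
  x≤ᵇy : (x ≤ᵇ y) ≡ true
  x≤ᵇy = reflects-true (≤ᵇ-reflects-≤ x y) x≤y
  byIndex : ∀ l → Divides (afterStep l) (y ∷ T)
  byIndex (suc p) with IRstep-Divides T m m∣T
  ... | step∣T , len≡ = cong₂ _∧_ x≤ᵇy step∣T , cong suc len≡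
  byIndex zero with suc x ≤ᵇ y in sx≤ᵇy
  ... | true rewrite divides m∣T = cong₂ _∧_ sx≤ᵇy (divides m∣T) , sameLength x∷m∣y∷T
  ... | false = x∷m∣y∷T

sum-IRstep : ∀ T m → Divides m T → sum m < sum T → sum (IRstep T m) ≡ suc (sum m)
sum-IRstep T m m∣T sum< with largestIndex-nonzero T m m∣T sum<
... | p , l≡ = trans (cong sum (trans (IRstep≡multiplyBy T m) (cong (multiplyBy m) l≡))) (sum-·var m p)

module IRSequence (T m₀ : Monomial) (m₀∣T : Divides m₀ T) where

  steps : ℕ
  steps = sum T ∸ sum m₀

  sum-m₀≤ : sum m₀ ≤ sum T
  sum-m₀≤ = divᵇ⇒sum-≤ m₀ T (divides m₀∣T)

  IRseq : ℕ → Monomial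
  IRseq j = iterate (IRstep T) j m₀

  private
    unsaturated : ∀ j → suc j ≤ steps → sum m₀ + j < sum T
    unsaturated j j<steps = begin-strict
      sum m₀ + j     <⟨ +-monoʳ-< (sum m₀) j<steps ⟩
      sum m₀ + steps ≡⟨ m+[n∸m]≡n sum-m₀≤ ⟩
      sum T          ∎
      where open ≤-Reasoning

  IRseq-Divides-sum : ∀ j → j ≤ steps → Divides (IRseq j) T × sum (IRseq j) ≡ sum m₀ + j
  IRseq-Divides-sum zero _ = m₀∣T , sym (+-identityʳ (sum m₀))
  IRseq-Divides-sum (suc j) j<steps with IRseq-Divides-sum j (≤-trans (n≤1+n j) j<steps)
  ... | mj∣T , sum≡ = IRstep-Divides T (IRseq j) mj∣T ,
    trans (sum-IRstep T (IRseq j) mj∣T (subst (_< sum T) (sym sum≡) (unsaturated j j<steps)))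
          (trans (cong suc sum≡) (sym (+-suc (sum m₀) j)))

  IRseq-unsaturated : ∀ j → suc j ≤ steps → Divides (IRseq j) T × sum (IRseq j) < sum T
  IRseq-unsaturated j j<steps with IRseq-Divides-sum j (≤-trans (n≤1+n j) j<steps)
  ... | mj∣T , sum≡ = mj∣T , subst (_< sum T) (sym sum≡) (unsaturated j j<steps)

  IRseq-saturated : Divides (IRseq steps) T × sum (IRseq steps) ≡ sum T
  IRseq-saturated with IRseq-Divides-sum steps ≤-refl
  ... | m∣T , sum≡ = m∣T , trans sum≡ (m+[n∸m]≡n sum-m₀≤)

  module WithHead (a A : ℕ) (a≤A : a ≤ A) where

    IRseq-∷ : ℕ → Monomial
    IRseq-∷ j = iterate (IRstep (A ∷ T)) j (a ∷ m₀)

    IRseq-∷-tail : ∀ j → j ≤ steps → IRseq-∷ j ≡ a ∷ IRseq j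
    IRseq-∷-tail zero _ = refl
    IRseq-∷-tail (suc j) j<steps with IRseq-unsaturated j j<steps
    ... | mj∣T , sum< = begin
      IRstep (A ∷ T) (IRseq-∷ j)                  ≡⟨ cong (IRstep (A ∷ T)) (IRseq-∷-tail j (≤-trans (n≤1+n j) j<steps)) ⟩
      IRstep (A ∷ T) (a ∷ IRseq j)                ≡⟨ IRstep-∷ ⟩
      afterStep (largestIndex T (IRseq j))        ≡⟨ cong afterStep (proj₂ (largestIndex-nonzero T (IRseq j) mj∣T sum<)) ⟩
      a ∷ IRseq (suc j)                           ∎
      where
      open ≡-Reasoning
      open ConsStep a A T (IRseq j) a≤A

    IRseq-∷-head : ∀ k → a + k ≤ A → IRseq-∷ (steps + k) ≡ (a + k) ∷ IRseq steps
    IRseq-∷-head zero _ = trans (cong IRseq-∷ (+-identityʳ steps))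
      (trans (IRseq-∷-tail steps ≤-refl) (cong (_∷ IRseq steps) (sym (+-identityʳ a))))
    IRseq-∷-head (suc k) a+k<A = begin
      IRseq-∷ (steps + suc k)                     ≡⟨ cong IRseq-∷ (+-suc steps k) ⟩
      IRstep (A ∷ T) (IRseq-∷ (steps + k))        ≡⟨ cong (IRstep (A ∷ T)) (IRseq-∷-head k a+k≤A) ⟩
      IRstep (A ∷ T) ((a + k) ∷ IRseq steps)      ≡⟨ IRstep-∷ ⟩
      afterStep (largestIndex T (IRseq steps))    ≡⟨ cong afterStep (largestIndex-zero T _ (proj₁ IRseq-saturated) (proj₂ IRseq-saturated)) ⟩
      afterStep 0                                 ≡⟨ cong (λ b → if b then suc (a + k) ∷ IRseq steps else (a + k) ∷ IRseq steps) raised ⟩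
      suc (a + k) ∷ IRseq steps                   ≡⟨ cong (_∷ IRseq steps) (+-suc a k) ⟨
      (a + suc k) ∷ IRseq steps                   ∎
      where
      open ≡-Reasoning
      a+k≤A : a + k ≤ A
      a+k≤A = ≤-trans (+-monoʳ-≤ a (n≤1+n k)) a+k<A
      open ConsStep (a + k) A T (IRseq steps) a+k≤A
      raised : raiseHead ≡ true
      raised = cong₂ _∧_ (reflects-true (≤ᵇ-reflects-≤ (suc (a + k)) A) (subst (_≤ A) (+-suc a k) a+k<A))
                         (divides (proj₁ IRseq-saturated))

-- Decomposing w = (a , u)

countBelow : ℕ → List ℕ → ℕ
countBelow x L = length (filterᵇ (_<ᵇ x) L)

countBelow-↭ : ∀ x {L L′} → L ↭ L′ → countBelow x L ≡ countBelow x L′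
countBelow-↭ x L↭L′ = ↭-length (↭.filter-↭ (T? ∘ (_<ᵇ x)) L↭L′)

countBelow-self : ∀ x L → countBelow x (x ∷ L) ≡ countBelow x L
countBelow-self x L rewrite <ᵇ-irrefl x = refl

countBelow-mono : ∀ {x y} → x ≤ y → ∀ L → countBelow x L ≤ countBelow y L
countBelow-mono x≤y [] = z≤n
countBelow-mono {x} {y} x≤y (z ∷ L) with z <ᵇ x in z<ᵇx | z <ᵇ y in z<ᵇy
... | true | true = s≤s (countBelow-mono x≤y L)
... | false | true = m≤n⇒m≤1+n (countBelow-mono x≤y L)
... | false | false = countBelow-mono x≤y L
... | true | false = ⊥-elim (false-reflects (<ᵇ-reflects-< z y) z<ᵇy (≤-trans (true-reflects (<ᵇ-reflects-< z x) z<ᵇx) x≤y))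

countBelow-strict : ∀ {x y} → x < y → ∀ L → x ∈ L → countBelow x L < countBelow y L
countBelow-strict {x} {y} x<y (_ ∷ L) (here refl)
  rewrite <ᵇ-irrefl x | reflects-true (<ᵇ-reflects-< x y) x<y = s≤s (countBelow-mono (<⇒≤ x<y) L)
countBelow-strict {x} {y} x<y (z ∷ L) (there x∈L) with z <ᵇ x in z<ᵇx | z <ᵇ y in z<ᵇy
... | true | true = s≤s (countBelow-strict x<y L x∈L)
... | false | true = m<n⇒m<1+n (countBelow-strict x<y L x∈L)
... | false | false = countBelow-strict x<y L x∈L
... | true | false = ⊥-elim (false-reflects (<ᵇ-reflects-< z y) z<ᵇy (<-trans (true-reflects (<ᵇ-reflects-< z x) z<ᵇx) x<y))

countBelow-injective : ∀ {x y} L → x ∈ L → y ∈ L → countBelow x L ≡ countBelow y L → x ≡ y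
countBelow-injective {x} {y} L x∈L y∈L c≡ with <-cmp x y
... | tri< x<y _ _ = ⊥-elim (<-irrefl c≡ (countBelow-strict x<y L x∈L))
... | tri≈ _ x≡y _ = x≡y
... | tri> _ _ y<x = ⊥-elim (<-irrefl (sym c≡) (countBelow-strict y<x L y∈L))

invcode-injective : ∀ {v v′} → v′ ↭ v → invcode v′ ≡ invcode v → v′ ≡ v
invcode-injective {[]} {[]} _ _ = refl
invcode-injective {[]} {_ ∷ _} v′↭v _ with ↭-length v′↭v
... | ()
invcode-injective {_ ∷ _} {[]} v′↭v _ with ↭-length v′↭v
... | ()
invcode-injective {y ∷ v} {y′ ∷ v′} v′↭v code≡ = cong₂ _∷_ y′≡y (invcode-injective (drop-∷ (subst (λ z → z ∷ v′ ↭ y ∷ v) y′≡y v′↭v)) (List.∷-injectiveʳ code≡))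
  where
  y′≡y : y′ ≡ y
  y′≡y = countBelow-injective (y ∷ v) (∈-resp-↭ v′↭v (here refl)) (here refl) (begin
    countBelow y′ (y ∷ v)   ≡⟨ countBelow-↭ y′ v′↭v ⟨
    countBelow y′ (y′ ∷ v′) ≡⟨ countBelow-self y′ v′ ⟩
    countBelow y′ v′        ≡⟨ List.∷-injectiveˡ code≡ ⟩
    countBelow y v          ≡⟨ countBelow-self y v ⟨
    countBelow y (y ∷ v)    ∎)
    where open ≡-Reasoning

invcode-map : (g : ℕ → ℕ) → (∀ {y z} → y < z → g y < g z) → ∀ v → invcode (map g v) ≡ invcode v
invcode-map g g-< [] = refl
invcode-map g g-< (y ∷ v) = cong₂ _∷_ countBelow-map (invcode-map g g-< v)
  where
  open StrictlyMonotone g g-<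
  countBelow-map : countBelow (g y) (map g v) ≡ countBelow y v
  countBelow-map = trans (cong length (filterᵇ-map (_<ᵇ g y) g v))
    (trans (List.length-map g (filterᵇ ((_<ᵇ g y) ∘ g) v))
           (cong length (filterᵇ-cong (All.tabulate {xs = v} λ {z} _ → g-<ᵇ z y))))

countBelow-upTo : ∀ n k → k ≤ n → countBelow k (upTo n) ≡ k
countBelow-upTo n zero _ = cong length (filterᵇ-none (_<ᵇ 0) (All.tabulate {xs = upTo n} λ _ → refl))
countBelow-upTo (suc n) (suc k) (s≤s k≤n) = begin
  countBelow (suc k) (upTo (suc n))                    ≡⟨ cong (countBelow (suc k)) (upTo-suc n) ⟩
  countBelow (suc k) (0 ∷ map suc (upTo n))            ≡⟨ cong (suc ∘ length) (filterᵇ-map (_<ᵇ suc k) suc (upTo n)) ⟩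
  suc (length (map suc (filterᵇ (_<ᵇ k) (upTo n))))    ≡⟨ cong suc (List.length-map suc (filterᵇ (_<ᵇ k) (upTo n))) ⟩
  suc (countBelow k (upTo n))                          ≡⟨ cong suc (countBelow-upTo n k k≤n) ⟩
  suc k                                                ∎
  where open ≡-Reasoning

countBelow-range1 : ∀ n {x} → x ∈ range1 n → ∃ λ k → x ≡ suc k × countBelow x (range1 n) ≡ k
countBelow-range1 n x∈ with ∈-map⁻ suc x∈
... | k , k∈upTo , refl = k , refl , (begin
  countBelow (suc k) (map suc (upTo n))           ≡⟨ cong length (filterᵇ-map (_<ᵇ suc k) suc (upTo n)) ⟩
  length (map suc (filterᵇ (_<ᵇ k) (upTo n)))    ≡⟨ List.length-map suc (filterᵇ (_<ᵇ k) (upTo n)) ⟩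
  countBelow k (upTo n)                          ≡⟨ countBelow-upTo n k (<⇒≤ (∈-upTo⁻ k∈upTo)) ⟩
  k                                              ∎)
  where open ≡-Reasoning

liftAbove-suc : ∀ a k → liftAbove (suc a) (suc k) ≡ suc (liftAbove a k)
liftAbove-suc a k with k ≤? a
... | yes k≤a = trans (liftAbove-≤ (suc a) (s≤s k≤a)) (cong suc (sym (liftAbove-≤ a k≤a)))
... | no k≰a = trans (liftAbove-> (suc a) (s≤s (≰⇒> k≰a))) (cong suc (sym (liftAbove-> a (≰⇒> k≰a))))

range1-↭-lift : ∀ a m → a ≤ m → range1 (suc m) ↭ suc a ∷ map (liftAbove a) (range1 m)
range1-↭-lift zero m _ = ↭-reflexive (trans (range1-suc m) (cong (1 ∷_)
  (trans (sym (List.map-∘ {g = suc} (upTo m))) (List.map-∘ {g = liftAbove 0} (upTo m)))))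
range1-↭-lift (suc a) (suc m) (s≤s a≤m) = begin
  range1 (suc (suc m))                                    ≡⟨ range1-suc (suc m) ⟩
  1 ∷ map suc (range1 (suc m))                            ↭⟨ prep 1 (↭.map⁺ suc (range1-↭-lift a m a≤m)) ⟩
  1 ∷ suc (suc a) ∷ map suc (map (liftAbove a) (range1 m)) ↭⟨ swap 1 (suc (suc a)) ↭-refl ⟩
  suc (suc a) ∷ 1 ∷ map suc (map (liftAbove a) (range1 m)) ≡⟨ cong (suc (suc a) ∷_) lifted ⟨
  suc (suc a) ∷ map (liftAbove (suc a)) (range1 (suc m)) ∎
  where
  open PermutationReasoning
  lifted : map (liftAbove (suc a)) (range1 (suc m)) ≡ 1 ∷ map suc (map (liftAbove a) (range1 m))
  lifted = trans (map-range1-suc (liftAbove (suc a)) (suc ∘ liftAbove a) m (λ k → liftAbove-suc a (suc k)))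
                 (cong (1 ∷_) (List.map-∘ (range1 m)))

decompose : ∀ n a w u → IsPerm n w → IsPerm (n ∸ 1) u → invcode w ≡ a ∷ invcode u →
  w ≡ suc a ∷ map (liftAbove a) u
decompose n a [] u _ _ ()
decompose zero a (x ∷ w′) u w↭ _ _ with ↭-length w↭
... | ()
decompose (suc m) a (x ∷ w′) u w↭ u↭ code≡ = cong₂ _∷_ x≡ w′≡
  where
  below≡a : countBelow x w′ ≡ a
  below≡a = List.∷-injectiveˡ code≡
  x≡ : x ≡ suc a
  x≡ with countBelow-range1 (suc m) (∈-resp-↭ w↭ (here refl))
  ... | k , refl , below≡k = cong suc (begin
    k                            ≡⟨ below≡k ⟨
    countBelow x (range1 (suc m)) ≡⟨ countBelow-↭ x w↭ ⟨
    countBelow x (x ∷ w′)         ≡⟨ countBelow-self x w′ ⟩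
    countBelow x w′               ≡⟨ below≡a ⟩
    a                            ∎)
    where open ≡-Reasoning
  a≤m : a ≤ m
  a≤m = subst₂ _≤_ below≡a (suc-injective (trans (↭-length w↭) (length-range1 (suc m))))
    (List.length-filter (T? ∘ (_<ᵇ x)) w′)
  w′↭ : w′ ↭ map (liftAbove a) u
  w′↭ = drop-∷ (begin
    suc a ∷ w′                               ≡⟨ cong (_∷ w′) x≡ ⟨
    x ∷ w′                                   ↭⟨ w↭ ⟩
    range1 (suc m)                           ↭⟨ range1-↭-lift a m a≤m ⟩
    suc a ∷ map (liftAbove a) (range1 m)     ↭⟨ prep (suc a) (↭.map⁺ (liftAbove a) (↭-sym u↭)) ⟩
    suc a ∷ map (liftAbove a) u              ∎)
    where open PermutationReasoning
  w′≡ : w′ ≡ map (liftAbove a) u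
  w′≡ = invcode-injective w′↭ (trans (List.∷-injectiveʳ code≡) (sym (invcode-map (liftAbove a) (liftAbove-< a) u)))

invcode-Divides-rajcode : ∀ u → Divides (invcode u) (rajcode u)
invcode-Divides-rajcode u = subst (λ m → Divides m (rajcode u)) (rowCounts-rothe u)
  (divᵇ-map (range1 (length u)) , trans (List.length-map _ (range1 (length u))) (sym (List.length-map _ (range1 (length u)))))
  where
  rothe≤snow : ∀ r → rowCount (rothe u) r ≤ rowCount (snow u) r
  rothe≤snow r = subst (rowCount (rothe u) r ≤_) (sym (rowCount-++ (rothe u) _ r)) (m≤m+n _ _)
  divᵇ-map : ∀ rs → divᵇ (map (rowCount (rothe u)) rs) (map (rowCount (snow u)) rs) ≡ true
  divᵇ-map [] = refl
  divᵇ-map (r ∷ rs) = cong₂ _∧_ (reflects-true (≤ᵇ-reflects-≤ _ _) (rothe≤snow r)) (divᵇ-map rs)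

module LiftedIR (a : ℕ) (u : List ℕ) (code≡ : invcode (suc a ∷ map (liftAbove a) u) ≡ a ∷ invcode u) where

  private
    w : List ℕ
    w = suc a ∷ map (liftAbove a) u

  rajcode-w : rajcode w ≡ (a + d a u) ∷ rajcode u
  rajcode-w = LiftedRothe.rajcode-lift a u (List.∷-injectiveˡ code≡)

  open IRSequence (rajcode u) (invcode u) (invcode-Divides-rajcode u)
  open WithHead a (a + d a u) (m≤m+n a (d a u))

  IR-w : ∀ j → IR w j ≡ IRseq-∷ j
  IR-w j = cong₂ (λ t m → iterate (IRstep t) j m) rajcode-w code≡

  reg-w : reg w ≡ reg u + d a u
  reg-w = begin
    sum (rajcode w) ∸ sum (invcode w)                  ≡⟨ cong₂ (λ t m → sum t ∸ sum m) rajcode-w code≡ ⟩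
    (a + d a u + sum (rajcode u)) ∸ (a + sum (invcode u)) ≡⟨ cong (_∸ (a + sum (invcode u))) (+-assoc a (d a u) _) ⟩
    (a + (d a u + sum (rajcode u))) ∸ (a + sum (invcode u)) ≡⟨ [m+n]∸[m+o]≡n∸o a _ (sum (invcode u)) ⟩
    (d a u + sum (rajcode u)) ∸ sum (invcode u)        ≡⟨ +-∸-assoc (d a u) sum-m₀≤ ⟩
    d a u + reg u                                      ≡⟨ +-comm (d a u) (reg u) ⟩
    reg u + d a u                                      ∎
    where open ≡-Reasoning

  IR-w-tail : ∀ j → j ≤ reg u → IR w j ≡ x₁^ a · shift (IR u j)
  IR-w-tail j j≤ = trans (IR-w j) (trans (IRseq-∷-tail j j≤) (cong (_∷ IR u j) (sym (+-identityʳ a))))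

  IR-w-head : ∀ j → reg u < j → j ≤ reg w → IR w j ≡ x₁^ (a + (j ∸ reg u)) · shift (IR u (reg u))
  IR-w-head j reg< j≤ = begin
    IR w j                                   ≡⟨ IR-w j ⟩
    IRseq-∷ j                                ≡⟨ cong IRseq-∷ (m+[n∸m]≡n (<⇒≤ reg<)) ⟨
    IRseq-∷ (reg u + (j ∸ reg u))            ≡⟨ IRseq-∷-head (j ∸ reg u) (+-monoʳ-≤ a excess≤) ⟩
    (a + (j ∸ reg u)) ∷ IR u (reg u)          ≡⟨ cong (_∷ IR u (reg u)) (+-identityʳ _) ⟨
    x₁^ (a + (j ∸ reg u)) · shift (IR u (reg u)) ∎
    where
    open ≡-Reasoning
    excess≤ : j ∸ reg u ≤ d a u
    excess≤ = subst (j ∸ reg u ≤_) (m+n∸m≡n (reg u) (d a u)) (∸-monoˡ-≤ (reg u) (subst (j ≤_) reg-w j≤))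

proposition3p4 : (n : ℕ) → 2 ≤ n → (a : ℕ) (w u : List ℕ)
    → IsPerm n w → IsPerm (n ∸ 1) u → invcode w ≡ a ∷ invcode u
    → (reg w ≡ reg u + d a u)
      × ((j : ℕ) → j ≤ reg u → IR w j ≡ x₁^ a · shift (IR u j))
      × ((j : ℕ) → reg u < j → j ≤ reg w
           → IR w j ≡ x₁^ (a + (j ∸ reg u)) · shift (IR u (reg u)))
proposition3p4 n _ a w u w↭ u↭ code≡ with decompose n a w u w↭ u↭ code≡
... | refl = reg-w , IR-w-tail , IR-w-head
  where open LiftedIR a u code≡
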